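{- For every $n\geq1$, the set $\mathfrak{S}_n(24135,24153,42135,42153)$ is invariant under the MFS-action, i.e., $\varphi'_a(\pi)\in\mathfrak{S}_n(24135,24153,42135,42153)$ for every $\pi$ in this set and every $a\in[n]$.
   Context: $\mathfrak{S}_n$ is the set of permutations of $[n]$; $\mathfrak{S}_n(p_1,\dots,p_r)$ is the set of those containing no subsequence order isomorphic to any $p_i$. For $\pi\in\mathfrak{S}_n$ and $a\in[n]$, factor $\pi=w_1w_2aw_3w_4$ where $w_2$ (resp. $w_3$) is the maximal contiguous (possibly empty) factor immediately left (resp. right) of $a$ all of whose letters exceed $a$; the Foata–Strehl action is $\varphi_a(\pi)=w_1w_3aw_2w_4$. With $\pi_0=\pi_{n+1}=-\infty$ and $i=\pi^{ -1}(a)$, the MFS-action is $\varphi'_a(\pi)=\varphi_a(\pi)$ if $\pi_{i-1}<\pi_i<\pi_{i+1}$ or $\pi_{i-1}>\pi_i>\pi_{i+1}$, and $\varphi'_a(\pi)=\pi$ otherwise. -}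

module Defs where

open import Data.Nat using (ℕ; zero; suc; _<_; _<ᵇ_; _≡ᵇ_)
open import Data.Bool using (Bool; true; false; if_then_else_; _∧_)
open import Data.List using (List; []; _∷_; _++_; reverse; map; upTo; length)
open import Data.List.Membership.Propositional using (_∈_)
open import Data.List.Relation.Binary.Permutation.Propositional using (_↭_)
open import Data.List.Relation.Binary.Sublist.Propositional using (_⊆_)
open import Data.Maybe using (Maybe; just; nothing)
open import Data.Product using (_×_; _,_; proj₁; proj₂; ∃)
open import Function.Bundles using (_⇔_)
open import Relation.Nullary using (¬_)
open import Relation.Binary.PropositionalEquality using (_≡_)

IsPerm : ℕ → List ℕ → Set
IsPerm n π = π ↭ map suc (upTo n)

zipL : List ℕ → List ℕ → List (ℕ × ℕ)
zipL (x ∷ xs) (y ∷ ys) = (x , y) ∷ zipL xs ys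
zipL _ _ = []

OrderIso : List ℕ → List ℕ → Set
OrderIso σ p = length σ ≡ length p ×
  (∀ {u v} → u ∈ zipL σ p → v ∈ zipL σ p →
     (proj₁ u < proj₁ v) ⇔ (proj₂ u < proj₂ v))

Contains : List ℕ → List ℕ → Set
Contains π p = ∃ λ σ → σ ⊆ π × OrderIso σ p

Avoids : List ℕ → List ℕ → Set
Avoids π p = ¬ Contains π p

Avoids4 : List ℕ → Set
Avoids4 π = Avoids π (2 ∷ 4 ∷ 1 ∷ 3 ∷ 5 ∷ []) × Avoids π (2 ∷ 4 ∷ 1 ∷ 5 ∷ 3 ∷ [])
          × Avoids π (4 ∷ 2 ∷ 1 ∷ 3 ∷ 5 ∷ []) × Avoids π (4 ∷ 2 ∷ 1 ∷ 5 ∷ 3 ∷ [])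

splitAtLetter : ℕ → List ℕ → List ℕ × List ℕ
splitAtLetter a [] = [] , []
splitAtLetter a (x ∷ xs) with x ≡ᵇ a
... | true  = [] , xs
... | false = x ∷ proj₁ (splitAtLetter a xs) , proj₂ (splitAtLetter a xs)

takeBig : ℕ → List ℕ → List ℕ
takeBig a [] = []
takeBig a (x ∷ xs) = if a <ᵇ x then x ∷ takeBig a xs else []

dropBig : ℕ → List ℕ → List ℕ
dropBig a [] = []
dropBig a (x ∷ xs) = if a <ᵇ x then dropBig a xs else x ∷ xs

fs : ℕ → List ℕ → List ℕ
fs a π =
  let pre  = proj₁ (splitAtLetter a π)
      post = proj₂ (splitAtLetter a π)
      w₁ = reverse (dropBig a (reverse pre))
      w₂ = reverse (takeBig a (reverse pre))
      w₃ = takeBig a post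
      w₄ = dropBig a post
  in w₁ ++ w₃ ++ a ∷ w₂ ++ w₄

lastM : List ℕ → Maybe ℕ
lastM [] = nothing
lastM (x ∷ []) = just x
lastM (x ∷ y ∷ ys) = lastM (y ∷ ys)

headM : List ℕ → Maybe ℕ
headM [] = nothing
headM (x ∷ _) = just x

-- comparisons with neighbours, where a missing neighbour is -∞
-- (neighbour < a)
nbLess : Maybe ℕ → ℕ → Bool
nbLess nothing  a = true
nbLess (just x) a = x <ᵇ a

nbGreater : Maybe ℕ → ℕ → Bool
nbGreater nothing  a = false
nbGreater (just x) a = a <ᵇ x

-- a is a double ascent (π_{i-1} < a < π_{i+1}) or double descent
-- (π_{i-1} > a > π_{i+1}) of π, with π₀ = π_{n+1} = -∞
isDoubleAscOrDesc : ℕ → List ℕ → Bool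
isDoubleAscOrDesc a π with lastM (proj₁ (splitAtLetter a π)) | headM (proj₂ (splitAtLetter a π))
... | l | r = (nbLess l a ∧ nbGreater r a) Data.Bool.∨ (nbGreater l a ∧ nbLess r a)

mfs : ℕ → List ℕ → List ℕ
mfs a π = if isDoubleAscOrDesc a π then fs a π else π

-- φ'_a acts only when a is a double ascent or descent of π = w₁ w₂ a w₃ w₄,
-- and then w₂ or w₃ is empty: φ'_a moves a across a block of letters larger
-- than a, onto a letter smaller than a (or the end of the word).  Take an
-- occurrence of 24135, 24153, 42135 or 42153 in the image and move a back.
-- Since the 1 of these patterns is smaller than everything after it, and the
-- moved letters are larger than a, this only exchanges the first two or the
-- last two letters of the occurrence, which keeps it in the pattern class,
-- unless a plays the 1.  In that case the smaller neighbour of a on the far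
-- side of the block can play the 1 instead.
module Submission where

open import Defs
open import Data.Bool using (true; false; _∧_; _∨_)
open import Data.Empty using (⊥-elim)
open import Data.List using (List; []; _∷_; _++_; [_]; map; length; reverse; reverseAcc)
open import Data.List.Properties using (length-map; ++-assoc; reverse-++; reverse-involutive)
open import Data.List.Membership.Propositional using (_∈_)
open import Data.List.Membership.Propositional.Properties using (∈-++⁺ʳ; ∈-map⁺; ∈-upTo⁺)
open import Data.List.Relation.Unary.All as All using (All; []; _∷_; all?)
open import Data.List.Relation.Unary.AllPairs using (AllPairs; []; _∷_)
open import Data.List.Relation.Unary.Any using (here; there)
open import Data.List.Relation.Unary.Linked using (Linked; []; [-]; _∷_; linked?)
open import Data.List.Relation.Unary.Linked.Properties using (Linked⇒AllPairs)
open import Data.List.Relation.Binary.Sublist.Propositional using (_⊆_; []; _∷_; _∷ʳ_)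
open import Data.List.Relation.Binary.Sublist.Propositional.Properties
  using (++⁺; All-resp-⊆; reverse⁺; reverse⁻)
open import Data.List.Relation.Binary.Permutation.Propositional using (_↭_; ↭-sym; ↭-trans)
open import Data.List.Relation.Binary.Permutation.Propositional.Properties
  using (∈-resp-↭; shift; ++⁺ˡ; All-resp-↭; ↭-reverse)
open import Data.Maybe using (just)
open import Data.Nat using (ℕ; suc; _≤_; _<_; _≤?_; _<?_; _<ᵇ_; _≡ᵇ_; z≤n; s≤s)
open import Data.Nat.Properties
  using (<-cmp; <-irrefl; <-asym; <-trans; ≤-<-trans; <⇒≱; ≮⇒≥; suc-injective; <ᵇ-reflects-<; ≡ᵇ⇒≡; ≡⇒≡ᵇ)
open import Data.Product using (_×_; _,_; proj₁; proj₂; ∃; ∃₂)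
open import Data.Sum using (_⊎_; inj₁; inj₂)
open import Data.Unit using (⊤)
open import Function using (_∘_)
open import Function.Bundles using (_⇔_; mk⇔; Equivalence)
open import Relation.Binary.Definitions using (tri<; tri≈; tri>)
open import Relation.Binary.PropositionalEquality
  using (_≡_; _≢_; refl; sym; trans; cong; cong₂; subst; module ≡-Reasoning)
open import Relation.Nullary using (¬_; Dec; contradiction)
open import Relation.Nullary.Decidable using (True; toWitness; _×-dec_)
open import Relation.Nullary.Reflects using (ofʸ; ofⁿ)

-- The i-th letter of a word, counted from 1 like the letters of a pattern (0 when out of range).
at : List ℕ → ℕ → ℕ
at (v ∷ _)  1             = v
at (_ ∷ vs) (suc (suc i)) = at vs (suc i)
at _        _             = 0

InRange : ℕ → ℕ → Set
InRange n i = 1 ≤ i × i ≤ n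

inRange? : ∀ n i → Dec (InRange n i)
inRange? n i = (1 ≤? i) ×-dec (i ≤? n)

All-at : ∀ {P : ℕ → Set} {vs i} → All P vs → InRange (length vs) i → P (at vs i)
All-at {i = 1}           (pv ∷ _)  _             = pv
All-at {i = suc (suc i)} (_ ∷ pvs) (_ , s≤s i<n) = All-at pvs (s≤s z≤n , i<n)

at-strictMono : ∀ {vs i j} → AllPairs _<_ vs → InRange (length vs) i → InRange (length vs) j →
                i < j → at vs i < at vs j
at-strictMono {i = 1} {1} _ _ _ (s≤s ())
at-strictMono {i = 1} {suc (suc j)} (v< ∷ _) _ (_ , s≤s j<n) _ = All-at v< (s≤s z≤n , j<n)
at-strictMono {i = suc (suc i)} {suc (suc j)} (_ ∷ vs) (_ , s≤s i<n) (_ , s≤s j<n) (s≤s i<j) =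
  at-strictMono vs (s≤s z≤n , i<n) (s≤s z≤n , j<n) i<j

∈-zipL-map : ∀ (f : ℕ → ℕ) P {u} → u ∈ zipL (map f P) P → ∃ λ i → i ∈ P × u ≡ (f i , i)
∈-zipL-map f (i ∷ _) (here refl) = i , here refl , refl
∈-zipL-map f (_ ∷ P) (there u∈) with ∈-zipL-map f P u∈
... | i , i∈P , refl = i , there i∈P , refl

orderIso-relabel : ∀ (f : ℕ → ℕ) P → (∀ {i j} → i ∈ P → j ∈ P → i < j → f i < f j) →
                   OrderIso (map f P) P
orderIso-relabel f P mono = length-map f P , λ u∈ v∈ → iso (∈-zipL-map f P u∈) (∈-zipL-map f P v∈)
  where
  iso : ∀ {u v} → (∃ λ i → i ∈ P × u ≡ (f i , i)) → (∃ λ j → j ∈ P × v ≡ (f j , j)) →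
        (proj₁ u < proj₁ v) ⇔ (proj₂ u < proj₂ v)
  iso (i , i∈ , refl) (j , j∈ , refl) = mk⇔ reflect (mono i∈ j∈)
    where
    reflect : f i < f j → i < j
    reflect fi<fj with <-cmp i j
    ... | tri< i<j _ _ = i<j
    ... | tri≈ _ refl _ = contradiction fi<fj (<-irrefl refl)
    ... | tri> _ _ j<i = contradiction fi<fj (<-asym (mono j∈ i∈ j<i))

orderIso-at : ∀ {vs} P → Linked _<_ vs → All (InRange (length vs)) P → OrderIso (map (at vs) P) P
orderIso-at P sorted inRange =
  orderIso-relabel _ P λ i∈ j∈ → at-strictMono (Linked⇒AllPairs <-trans sorted)
                                   (All.lookup inRange i∈) (All.lookup inRange j∈)

at-∈-zipL : ∀ {s P i} → length s ≡ length P → InRange (length P) i → (at s i , at P i) ∈ zipL s P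
at-∈-zipL {_ ∷ _} {_ ∷ _} {1}           _   _             = here refl
at-∈-zipL {_ ∷ _} {_ ∷ _} {suc (suc i)} len (_ , s≤s i<n) =
  there (at-∈-zipL (suc-injective len) (s≤s z≤n , i<n))

linked-at : ∀ {s P} Q → OrderIso s P → All (InRange (length P)) Q →
            Linked _<_ (map (at P) Q) → Linked _<_ (map (at s) Q)
linked-at []          _ _ _ = []
linked-at (_ ∷ [])    _ _ _ = [-]
linked-at (i ∷ j ∷ Q) iso@(len , cmp) (i∈ ∷ j∈ ∷ Q∈) (Pi<Pj ∷ sorted) =
  Equivalence.from (cmp (at-∈-zipL len i∈) (at-∈-zipL len j∈)) Pi<Pj
  ∷ linked-at (j ∷ Q) iso (j∈ ∷ Q∈) sorted

-- Each constructor lists the letters playing 1, 2, 3, 4, 5.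
data Shape (x y z p q : ℕ) : Set where
  is24135 : Linked _<_ (z ∷ x ∷ p ∷ y ∷ q ∷ []) → Shape x y z p q
  is24153 : Linked _<_ (z ∷ x ∷ q ∷ y ∷ p ∷ []) → Shape x y z p q
  is42135 : Linked _<_ (z ∷ y ∷ p ∷ x ∷ q ∷ []) → Shape x y z p q
  is42153 : Linked _<_ (z ∷ y ∷ q ∷ x ∷ p ∷ []) → Shape x y z p q

data Forbidden : List ℕ → Set where
  forbidden : ∀ {x y z p q} → Shape x y z p q → Forbidden (x ∷ y ∷ z ∷ p ∷ q ∷ [])

HasForbidden : List ℕ → Set
HasForbidden π = ∃ λ s → s ⊆ π × Forbidden s

inRange₅ : ∀ P → {True (all? (inRange? 5) P)} → All (InRange 5) P
inRange₅ P {ok} = toWitness ok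

increasing₅ : Linked _<_ (1 ∷ 2 ∷ 3 ∷ 4 ∷ 5 ∷ [])
increasing₅ = toWitness {a? = linked? _<?_ (1 ∷ 2 ∷ 3 ∷ 4 ∷ 5 ∷ [])} _

forbidden-at : ∀ {s} → length s ≡ 5 → Shape (at s 1) (at s 2) (at s 3) (at s 4) (at s 5) → Forbidden s
forbidden-at {_ ∷ _ ∷ _ ∷ _ ∷ _ ∷ []} refl sh = forbidden sh

Avoids4⇒¬HasForbidden : ∀ {π} → Avoids4 π → ¬ HasForbidden π
Avoids4⇒¬HasForbidden (av₁ , av₂ , av₃ , av₄) (s , s⊆π , forbidden shape) with shape
... | is24135 c = av₁ (s , s⊆π , orderIso-at (2 ∷ 4 ∷ 1 ∷ 3 ∷ 5 ∷ []) c (inRange₅ _))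
... | is24153 c = av₂ (s , s⊆π , orderIso-at (2 ∷ 4 ∷ 1 ∷ 5 ∷ 3 ∷ []) c (inRange₅ _))
... | is42135 c = av₃ (s , s⊆π , orderIso-at (4 ∷ 2 ∷ 1 ∷ 3 ∷ 5 ∷ []) c (inRange₅ _))
... | is42153 c = av₄ (s , s⊆π , orderIso-at (4 ∷ 2 ∷ 1 ∷ 5 ∷ 3 ∷ []) c (inRange₅ _))

¬HasForbidden⇒Avoids4 : ∀ {π} → ¬ HasForbidden π → Avoids4 π
-- Each list below gives the positions of the letters 1, …, 5 in the corresponding pattern.
¬HasForbidden⇒Avoids4 nf =
    (λ (s , s⊆π , iso) → nf (s , s⊆π , forbidden-at (proj₁ iso)
                             (is24135 (linked-at (3 ∷ 1 ∷ 4 ∷ 2 ∷ 5 ∷ []) iso (inRange₅ _) increasing₅))))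
  , (λ (s , s⊆π , iso) → nf (s , s⊆π , forbidden-at (proj₁ iso)
                             (is24153 (linked-at (3 ∷ 1 ∷ 5 ∷ 2 ∷ 4 ∷ []) iso (inRange₅ _) increasing₅))))
  , (λ (s , s⊆π , iso) → nf (s , s⊆π , forbidden-at (proj₁ iso)
                             (is42135 (linked-at (3 ∷ 2 ∷ 4 ∷ 1 ∷ 5 ∷ []) iso (inRange₅ _) increasing₅))))
  , (λ (s , s⊆π , iso) → nf (s , s⊆π , forbidden-at (proj₁ iso)
                             (is42153 (linked-at (3 ∷ 2 ∷ 5 ∷ 1 ∷ 4 ∷ []) iso (inRange₅ _) increasing₅))))

swap-front : ∀ {x y z p q} → Shape x y z p q → Shape y x z p q
swap-front (is24135 c) = is42135 c
swap-front (is24153 c) = is42153 c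
swap-front (is42135 c) = is24135 c
swap-front (is42153 c) = is24153 c

swap-back : ∀ {x y z p q} → Shape x y z p q → Shape x y z q p
swap-back (is24135 c) = is24153 c
swap-back (is24153 c) = is24135 c
swap-back (is42135 c) = is42153 c
swap-back (is42153 c) = is42135 c

lower-third : ∀ {x y z p q c} → c ≤ z → Shape x y z p q → Shape x y c p q
lower-third c≤z (is24135 (z<x ∷ c)) = is24135 (≤-<-trans c≤z z<x ∷ c)
lower-third c≤z (is24153 (z<x ∷ c)) = is24153 (≤-<-trans c≤z z<x ∷ c)
lower-third c≤z (is42135 (z<y ∷ c)) = is42135 (≤-<-trans c≤z z<y ∷ c)
lower-third c≤z (is42153 (z<y ∷ c)) = is42153 (≤-<-trans c≤z z<y ∷ c)

third-least : ∀ {x y z r} → Forbidden (x ∷ y ∷ z ∷ r) → z < x × z < y × All (z <_) r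
third-least (forbidden (is24135 c)) with Linked⇒AllPairs <-trans c
... | (z<x ∷ z<p ∷ z<y ∷ z<q ∷ []) ∷ _ = z<x , z<y , z<p ∷ z<q ∷ []
third-least (forbidden (is24153 c)) with Linked⇒AllPairs <-trans c
... | (z<x ∷ z<q ∷ z<y ∷ z<p ∷ []) ∷ _ = z<x , z<y , z<p ∷ z<q ∷ []
third-least (forbidden (is42135 c)) with Linked⇒AllPairs <-trans c
... | (z<y ∷ z<p ∷ z<x ∷ z<q ∷ []) ∷ _ = z<x , z<y , z<p ∷ z<q ∷ []
third-least (forbidden (is42153 c)) with Linked⇒AllPairs <-trans c
... | (z<y ∷ z<q ∷ z<x ∷ z<p ∷ []) ∷ _ = z<x , z<y , z<p ∷ z<q ∷ []

third<later : ∀ {x y z a r} t → Forbidden (x ∷ y ∷ z ∷ t ++ a ∷ r) → z < a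
third<later t occ = let _ , _ , z<r = third-least occ in All.lookup z<r (∈-++⁺ʳ t (here refl))

-- a plays the 1 of the pattern in the occurrence l ++ a ∷ r.
record Lowerable (a : ℕ) (l r : List ℕ) : Set where
  field
    left-above  : All (a <_) l
    right-above : All (a <_) r
    left≢[]     : l ≢ []
    right≢[]    : r ≢ []
    lower       : ∀ {c} → c ≤ a → Forbidden (l ++ c ∷ r)

lowerable : ∀ {x y a p q} → Shape x y a p q → Lowerable a (x ∷ y ∷ []) (p ∷ q ∷ [])
lowerable sh = let a<x , a<y , a<pq = third-least (forbidden sh) in record
  { left-above  = a<x ∷ a<y ∷ []
  ; right-above = a<pq
  ; left≢[]     = λ ()
  ; right≢[]    = λ ()
  ; lower       = λ c≤a → forbidden (lower-third c≤a sh)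
  }

-- The 1 of the pattern is below every later letter, so it is not in t unless a is the 1;
-- otherwise a is the second letter passing the first, or the fifth passing the fourth.
forbidden-jumpˡ : ∀ a s t r → All (a <_) t → Forbidden (s ++ t ++ a ∷ r) →
                  Forbidden (s ++ a ∷ t ++ r) ⊎ Lowerable a (s ++ t) r
forbidden-jumpˡ a s [] r _ occ = inj₁ occ
forbidden-jumpˡ a [] (_ ∷ []) _ _ (forbidden sh) = inj₁ (forbidden (swap-front sh))
forbidden-jumpˡ a [] (_ ∷ _ ∷ []) _ _ (forbidden sh) = inj₂ (lowerable sh)
forbidden-jumpˡ a (_ ∷ []) (_ ∷ []) _ _ (forbidden sh) = inj₂ (lowerable sh)
forbidden-jumpˡ a (_ ∷ _ ∷ _ ∷ []) (_ ∷ []) _ _ (forbidden sh) = inj₁ (forbidden (swap-back sh))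
forbidden-jumpˡ a [] (_ ∷ _ ∷ _ ∷ t) _ (_ ∷ _ ∷ a<z ∷ _) occ = ⊥-elim (<-asym a<z (third<later t occ))
forbidden-jumpˡ a (_ ∷ []) (_ ∷ _ ∷ t) _ (_ ∷ a<z ∷ _) occ = ⊥-elim (<-asym a<z (third<later t occ))
forbidden-jumpˡ a (_ ∷ _ ∷ []) (_ ∷ t) _ (a<z ∷ _) occ = ⊥-elim (<-asym a<z (third<later t occ))
forbidden-jumpˡ a (_ ∷ _ ∷ _ ∷ []) (_ ∷ _ ∷ []) _ _ ()
forbidden-jumpˡ a (_ ∷ _ ∷ _ ∷ []) (_ ∷ _ ∷ _ ∷ _) _ _ ()
forbidden-jumpˡ a (_ ∷ _ ∷ _ ∷ _ ∷ []) (_ ∷ []) _ _ ()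
forbidden-jumpˡ a (_ ∷ _ ∷ _ ∷ _ ∷ []) (_ ∷ _ ∷ _) _ _ ()
forbidden-jumpˡ a (_ ∷ _ ∷ _ ∷ _ ∷ _ ∷ []) (_ ∷ _) _ _ ()
forbidden-jumpˡ a (_ ∷ _ ∷ _ ∷ _ ∷ _ ∷ _ ∷ _) (_ ∷ _) _ _ ()

forbidden-jumpʳ : ∀ a s t r → All (a <_) t → Forbidden (s ++ a ∷ t ++ r) →
                  Forbidden (s ++ t ++ a ∷ r) ⊎ Lowerable a s (t ++ r)
forbidden-jumpʳ a s [] r _ occ = inj₁ occ
forbidden-jumpʳ a [] (_ ∷ []) _ _ (forbidden sh) = inj₁ (forbidden (swap-front sh))
forbidden-jumpʳ a (_ ∷ _ ∷ []) (_ ∷ []) _ _ (forbidden sh) = inj₂ (lowerable sh)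
forbidden-jumpʳ a (_ ∷ _ ∷ []) (_ ∷ _ ∷ []) _ _ (forbidden sh) = inj₂ (lowerable sh)
forbidden-jumpʳ a (_ ∷ _ ∷ _ ∷ []) (_ ∷ []) _ _ (forbidden sh) = inj₁ (forbidden (swap-back sh))
forbidden-jumpʳ a [] (_ ∷ _ ∷ _) _ (_ ∷ a<z ∷ _) occ = ⊥-elim (<-asym a<z (proj₁ (third-least occ)))
forbidden-jumpʳ a (_ ∷ []) (_ ∷ _) _ (a<z ∷ _) occ = ⊥-elim (<-asym a<z (proj₁ (proj₂ (third-least occ))))
forbidden-jumpʳ a (_ ∷ _ ∷ _ ∷ _ ∷ []) (_ ∷ _) _ _ ()
forbidden-jumpʳ a (_ ∷ _ ∷ _ ∷ _ ∷ _ ∷ []) (_ ∷ _) _ _ ()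
forbidden-jumpʳ a (_ ∷ _ ∷ _ ∷ _ ∷ _ ∷ _ ∷ _) (_ ∷ _) _ _ ()

open Lowerable

⊆-++-split : ∀ (u : List ℕ) {w s} → s ⊆ u ++ w → ∃₂ λ s₁ s₂ → s ≡ s₁ ++ s₂ × s₁ ⊆ u × s₂ ⊆ w
⊆-++-split []      s⊆w        = [] , _ , refl , [] , s⊆w
⊆-++-split (x ∷ u) (.x ∷ʳ s⊆) with ⊆-++-split u s⊆
... | s₁ , s₂ , refl , s₁⊆ , s₂⊆ = s₁ , s₂ , refl , x ∷ʳ s₁⊆ , s₂⊆
⊆-++-split (x ∷ u) (refl ∷ s⊆) with ⊆-++-split u s⊆
... | s₁ , s₂ , refl , s₁⊆ , s₂⊆ = x ∷ s₁ , s₂ , refl , refl ∷ s₁⊆ , s₂⊆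

HeadAtMost : ℕ → List ℕ → Set
HeadAtMost a []      = ⊤
HeadAtMost a (c ∷ _) = c ≤ a

⊆-extendˡ : ∀ {a r w} → All (a <_) r → r ≢ [] → r ⊆ w → HeadAtMost a w → ∃ λ c → c ≤ a × c ∷ r ⊆ w
⊆-extendˡ _          r≢[] []          _   = ⊥-elim (r≢[] refl)
⊆-extendˡ _          _    (c ∷ʳ r⊆w)  c≤a = c , c≤a , refl ∷ r⊆w
⊆-extendˡ (a<c ∷ _)  _    (refl ∷ _)  c≤a = ⊥-elim (<⇒≱ a<c c≤a)

⊆-extendʳ : ∀ {a l u} → All (a <_) l → l ≢ [] → l ⊆ u → HeadAtMost a (reverse u) →
            ∃ λ c → c ≤ a × l ++ [ c ] ⊆ u
⊆-extendʳ {l = l} {u} l>a l≢[] l⊆u last≤a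
  with ⊆-extendˡ (All-resp-↭ (↭-sym (↭-reverse l)) l>a) reverse≢[] (reverse⁺ l⊆u) last≤a
  where
  reverse≢[] : reverse l ≢ []
  reverse≢[] eq = l≢[] (trans (sym (reverse-involutive l)) (cong reverse eq))
... | c , c≤a , c∷l⊆u = c , c≤a , reverse⁻ (subst (_⊆ reverse u) (sym (reverse-++ l [ c ])) c∷l⊆u)

hasForbidden-jumpˡ : ∀ a u v w → All (a <_) v → HeadAtMost a w →
                     HasForbidden (u ++ v ++ a ∷ w) → HasForbidden (u ++ a ∷ v ++ w)
hasForbidden-jumpˡ a u v w v>a w≤a (_ , s⊆ , occ)
  with ⊆-++-split u s⊆
... | s₁ , _ , refl , s₁⊆u , s′⊆ with ⊆-++-split v s′⊆
... | s₂ , _ , refl , s₂⊆v , (_ ∷ʳ s₃⊆w) = _ , ++⁺ s₁⊆u (a ∷ʳ ++⁺ s₂⊆v s₃⊆w) , occ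
... | s₂ , _ , refl , s₂⊆v , (refl ∷ s₃⊆w) with forbidden-jumpˡ a s₁ s₂ _ (All-resp-⊆ s₂⊆v v>a) occ
...   | inj₁ occ′ = _ , ++⁺ s₁⊆u (refl ∷ ++⁺ s₂⊆v s₃⊆w) , occ′
...   | inj₂ low with ⊆-extendˡ (right-above low) (right≢[] low) s₃⊆w w≤a
...     | c , c≤a , c∷s₃⊆w =
          _ , ++⁺ s₁⊆u (a ∷ʳ ++⁺ s₂⊆v c∷s₃⊆w) , subst Forbidden (++-assoc s₁ s₂ _) (lower low c≤a)

hasForbidden-jumpʳ : ∀ a u v w → All (a <_) v → HeadAtMost a (reverse u) →
                     HasForbidden (u ++ a ∷ v ++ w) → HasForbidden (u ++ v ++ a ∷ w)
hasForbidden-jumpʳ a u v w v>a last≤a (_ , s⊆ , occ)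
  with ⊆-++-split u s⊆
... | s₁ , _ , refl , s₁⊆u , (_ ∷ʳ s′⊆) with ⊆-++-split v s′⊆
...   | s₂ , s₃ , refl , s₂⊆v , s₃⊆w = _ , ++⁺ s₁⊆u (++⁺ s₂⊆v (a ∷ʳ s₃⊆w)) , occ
hasForbidden-jumpʳ a u v w v>a last≤a (_ , s⊆ , occ)
    | s₁ , _ , refl , s₁⊆u , (refl ∷ s′⊆) with ⊆-++-split v s′⊆
...   | s₂ , s₃ , refl , s₂⊆v , s₃⊆w with forbidden-jumpʳ a s₁ s₂ s₃ (All-resp-⊆ s₂⊆v v>a) occ
...     | inj₁ occ′ = _ , ++⁺ s₁⊆u (++⁺ s₂⊆v (refl ∷ s₃⊆w)) , occ′
...     | inj₂ low with ⊆-extendʳ (left-above low) (left≢[] low) s₁⊆u last≤a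
...       | c , c≤a , s₁c⊆u =
            _ , ++⁺ s₁c⊆u (++⁺ s₂⊆v (a ∷ʳ s₃⊆w)) ,
            subst Forbidden (sym (++-assoc s₁ [ c ] _)) (lower low c≤a)

data Jump (a : ℕ) : List ℕ → List ℕ → Set where
  jumpʳ : ∀ {u v w} → All (a <_) v → HeadAtMost a w → Jump a (u ++ a ∷ v ++ w) (u ++ v ++ a ∷ w)
  jumpˡ : ∀ {u v w} → All (a <_) v → HeadAtMost a (reverse u) → Jump a (u ++ v ++ a ∷ w) (u ++ a ∷ v ++ w)

Jump-↭ : ∀ {a π π′} → Jump a π π′ → π′ ↭ π
Jump-↭ {a} (jumpʳ {u} {v} {w} _ _) = ++⁺ˡ u (shift a v w)
Jump-↭ {a} (jumpˡ {u} {v} {w} _ _) = ++⁺ˡ u (↭-sym (shift a v w))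

Jump-reflects-HasForbidden : ∀ {a π π′} → Jump a π π′ → HasForbidden π′ → HasForbidden π
Jump-reflects-HasForbidden {a} (jumpʳ {u} {v} {w} v>a w≤a)    = hasForbidden-jumpˡ a u v w v>a w≤a
Jump-reflects-HasForbidden {a} (jumpˡ {u} {v} {w} v>a last≤a) = hasForbidden-jumpʳ a u v w v>a last≤a

Jump-between-blocks : ∀ {a} w₁ w₂ w₃ w₄ → All (a <_) w₂ → All (a <_) w₃ →
                      HeadAtMost a (reverse w₁) → HeadAtMost a w₄ → w₂ ≡ [] ⊎ w₃ ≡ [] →
                      Jump a (w₁ ++ w₂ ++ a ∷ w₃ ++ w₄) (w₁ ++ w₃ ++ a ∷ w₂ ++ w₄)
Jump-between-blocks _ _ _ _ _   w₃>a _      w₄≤a (inj₁ refl) = jumpʳ w₃>a w₄≤a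
Jump-between-blocks _ _ _ _ w₂>a _   last≤a _    (inj₂ refl) = jumpˡ w₂>a last≤a

before after : ℕ → List ℕ → List ℕ
before a π = proj₁ (splitAtLetter a π)
after  a π = proj₂ (splitAtLetter a π)

splitAtLetter-++ : ∀ {a π} → a ∈ π → π ≡ before a π ++ a ∷ after a π
splitAtLetter-++ {a} {x ∷ π} a∈ with x ≡ᵇ a | ≡ᵇ⇒≡ x a | ≡⇒≡ᵇ x a
... | true  | x≡a | _ = cong (_∷ π) (x≡a _)
... | false | _   | x≢a with a∈
...   | here refl = ⊥-elim (x≢a refl)
...   | there a∈π = cong (x ∷_) (splitAtLetter-++ a∈π)

takeBig-++-dropBig : ∀ a l → takeBig a l ++ dropBig a l ≡ l
takeBig-++-dropBig a []      = refl
takeBig-++-dropBig a (x ∷ l) with a <ᵇ x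
... | true  = cong (x ∷_) (takeBig-++-dropBig a l)
... | false = refl

takeBig-above : ∀ a l → All (a <_) (takeBig a l)
takeBig-above a []      = []
takeBig-above a (x ∷ l) with a <ᵇ x | <ᵇ-reflects-< a x
... | true  | ofʸ a<x = a<x ∷ takeBig-above a l
... | false | _       = []

dropBig-head : ∀ a l → HeadAtMost a (dropBig a l)
dropBig-head a []      = _
dropBig-head a (x ∷ l) with a <ᵇ x | <ᵇ-reflects-< a x
... | true  | _        = dropBig-head a l
... | false | ofⁿ a≮x = ≮⇒≥ a≮x

takeBig-head : ∀ a l → takeBig a l ≡ [] ⊎ nbGreater (headM l) a ≡ true
takeBig-head a []      = inj₁ refl
takeBig-head a (x ∷ l) with a <ᵇ x
... | true  = inj₂ refl
... | false = inj₁ refl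

headM-reverse : ∀ l → headM (reverse l) ≡ lastM l
headM-reverse []      = refl
headM-reverse (x ∷ l) = go [] x l
  where
  go : ∀ acc x l → headM (reverseAcc acc (x ∷ l)) ≡ lastM (x ∷ l)
  go acc x []      = refl
  go acc x (y ∷ l) = go (x ∷ acc) y l

greater⇒¬less : ∀ {a} m → nbGreater m a ≡ true → nbLess m a ≡ false
greater⇒¬less {a} (just t) greater with a <ᵇ t | <ᵇ-reflects-< a t | t <ᵇ a | <ᵇ-reflects-< t a
... | true | ofʸ a<t | true  | ofʸ t<a = ⊥-elim (<-asym a<t t<a)
... | true | _       | false | _       = refl

valley-not-double : ∀ a l r → nbGreater l a ≡ true → nbGreater r a ≡ true →
                    ((nbLess l a ∧ nbGreater r a) ∨ (nbGreater l a ∧ nbLess r a)) ≡ false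
valley-not-double a l r l>a r>a rewrite l>a | r>a | greater⇒¬less l l>a | greater⇒¬less r r>a = refl

w₁ w₂ w₃ w₄ : ℕ → List ℕ → List ℕ
w₁ a π = reverse (dropBig a (reverse (before a π)))
w₂ a π = reverse (takeBig a (reverse (before a π)))
w₃ a π = takeBig a (after a π)
w₄ a π = dropBig a (after a π)

before-blocks : ∀ a π → before a π ≡ w₁ a π ++ w₂ a π
before-blocks a π = begin
  before a π                                   ≡⟨ sym (reverse-involutive (before a π)) ⟩
  reverse ρ                                    ≡⟨ cong reverse (sym (takeBig-++-dropBig a ρ)) ⟩
  reverse (takeBig a ρ ++ dropBig a ρ)         ≡⟨ reverse-++ (takeBig a ρ) (dropBig a ρ) ⟩
  reverse (dropBig a ρ) ++ reverse (takeBig a ρ) ∎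
  where
  open ≡-Reasoning
  ρ = reverse (before a π)

blocks-++ : ∀ {a π} → a ∈ π → π ≡ w₁ a π ++ w₂ a π ++ a ∷ w₃ a π ++ w₄ a π
blocks-++ {a} {π} a∈π = begin
  π                                          ≡⟨ splitAtLetter-++ a∈π ⟩
  before a π ++ a ∷ after a π                ≡⟨ cong₂ (λ l r → l ++ a ∷ r) (before-blocks a π)
                                                                (sym (takeBig-++-dropBig a (after a π))) ⟩
  (w₁ a π ++ w₂ a π) ++ a ∷ w₃ a π ++ w₄ a π ≡⟨ ++-assoc (w₁ a π) (w₂ a π) (a ∷ w₃ a π ++ w₄ a π) ⟩
  w₁ a π ++ w₂ a π ++ a ∷ w₃ a π ++ w₄ a π   ∎
  where open ≡-Reasoning

double⇒block-empty : ∀ a π → isDoubleAscOrDesc a π ≡ true → w₂ a π ≡ [] ⊎ w₃ a π ≡ []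
double⇒block-empty a π double with takeBig-head a (reverse (before a π)) | takeBig-head a (after a π)
... | inj₁ none | _         = inj₁ (cong reverse none)
... | inj₂ _    | inj₁ none = inj₂ none
... | inj₂ l>a  | inj₂ r>a
  with trans (sym double) (valley-not-double a (lastM (before a π)) (headM (after a π))
                                  (subst (λ m → nbGreater m a ≡ true) (headM-reverse (before a π)) l>a) r>a)
...   | ()

fs-Jump : ∀ {a π} → a ∈ π → isDoubleAscOrDesc a π ≡ true → Jump a π (fs a π)
fs-Jump {a} {π} a∈π double =
  subst (λ σ → Jump a σ (fs a π)) (sym (blocks-++ a∈π))
    (Jump-between-blocks (w₁ a π) (w₂ a π) (w₃ a π) (w₄ a π)
      (All-resp-↭ (↭-sym (↭-reverse (takeBig a ρ))) (takeBig-above a ρ)) (takeBig-above a (after a π))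
      (subst (HeadAtMost a) (sym (reverse-involutive (dropBig a ρ))) (dropBig-head a ρ)) (dropBig-head a (after a π))
      (double⇒block-empty a π double))
  where
  ρ = reverse (before a π)

mfs-step : ∀ {a π} → a ∈ π → mfs a π ≡ π ⊎ Jump a π (mfs a π)
mfs-step {a} {π} a∈π with isDoubleAscOrDesc a π in double
... | false = inj₁ refl
... | true  = inj₂ (fs-Jump a∈π double)

IsPerm-∈ : ∀ {n π a} → IsPerm n π → 1 ≤ a → a ≤ n → a ∈ π
IsPerm-∈ π↭[n] (s≤s _) a≤n = ∈-resp-↭ (↭-sym π↭[n]) (∈-map⁺ suc (∈-upTo⁺ a≤n))

lemma3p7 : (n : ℕ) → 1 ≤ n → (π : List ℕ) → IsPerm n π → Avoids4 π →
    (a : ℕ) → 1 ≤ a → a ≤ n → IsPerm n (mfs a π) × Avoids4 (mfs a π)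
lemma3p7 n _ π π↭[n] avoids a 1≤a a≤n with mfs-step (IsPerm-∈ π↭[n] 1≤a a≤n)
... | inj₁ unchanged rewrite unchanged = π↭[n] , avoids
... | inj₂ jump = ↭-trans (Jump-↭ jump) π↭[n] ,
                  ¬HasForbidden⇒Avoids4 (Avoids4⇒¬HasForbidden avoids ∘ Jump-reflects-HasForbidden jump)
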